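{- Let $G=(V,E)$ be a graph with $|E|=m\ge1$, let $k$ be the size of a maximum matching of $G$, let $\Omega$ be the set of all matchings of $G$, and let $\lambda>0$. Consider the Markov chain on $\Omega$ with transition matrix $P$ which, from state $\sigma$, chooses an edge $e_r$ uniformly at random from $E$, sets $\sigma'=\sigma\cup\{e_r\}$ with probability $\frac{\lambda}{1+\lambda}$ and $\sigma'=\sigma\setminus\{e_r\}$ with probability $\frac{1}{1+\lambda}$, and moves to $\sigma'$ if $\sigma'$ is a matching and stays at $\sigma$ otherwise; let $\pi(M)=\lambda^{|M|}/\sum_{x\in\Omega}\lambda^{|x|}$ be its stationary distribution. Then the conductance $\phi$ of this chain satisfies $\phi\le O\!\left(\frac{k}{m}\right)$.
   Context: A matching is a set of edges no two of which share an endpoint. The conductance of the chain is $\phi=\min_{\emptyset\ne S\subsetneq\Omega}\frac{\sum_{i\in S,\,j\in\Omega\setminus S}\pi_iP_{ij}}{\left(\sum_{i\in S}\pi_i\right)\left(\sum_{i\in\Omega\setminus S}\pi_i\right)}$.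
   Formalization: The parameter λ ranges over the positive rationals. -}

module Defs where

open import Data.Nat as ℕ using (ℕ; zero; suc)
open import Data.Fin as Fin using (Fin)
open import Data.Bool using (Bool; true; false; _∧_; _∨_; not; _xor_; if_then_else_)
open import Data.Vec as Vec using (Vec; []; _∷_; lookup; _[_]≔_)
open import Data.List as List using (List; map; foldr; filterᵇ; allFin; length; _++_)
open import Data.Integer using (+_)
import Data.Bool.ListAction as BL
open import Data.Rational as ℚ using (ℚ; 0ℚ; 1ℚ; _+_; _*_; _÷_; _⊓_)
open import Data.Product using (_×_; _,_; proj₁; proj₂)
open import Data.Sum using (_⊎_)
open import Relation.Binary.PropositionalEquality using (_≡_; _≢_)
open import Relation.Nullary using (yes; no)
open import Relation.Nullary.Decidable using (⌊_⌋)

-- A graph G = (V, E) with V = Fin n and m edges, the edge list given by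
-- E : Fin m → Fin n × Fin n (edge i has endpoints proj₁ (E i), proj₂ (E i)).
Edges : ℕ → ℕ → Set
Edges n m = Fin m → Fin n × Fin n

SameEdge : ∀ {n} → Fin n × Fin n → Fin n × Fin n → Set
SameEdge (u , v) (u' , v') = (u ≡ u' × v ≡ v') ⊎ (u ≡ v' × v ≡ u')

SimpleGraph : ∀ {n m} → Edges n m → Set
SimpleGraph {n} {m} E =
  ((i : Fin m) → proj₁ (E i) ≢ proj₂ (E i)) ×
  ((i j : Fin m) → SameEdge (E i) (E j) → i ≡ j)

-- Edge sets are subsets of Fin m, as boolean vectors (Data.Fin.Subset style).
EdgeSet : ℕ → Set
EdgeSet m = Vec Bool m

_==ᶠ_ : ∀ {n} → Fin n → Fin n → Bool
a ==ᶠ b = ⌊ a Fin.≟ b ⌋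

shareEndpoint : ∀ {n} → Fin n × Fin n → Fin n × Fin n → Bool
shareEndpoint e f =
  (proj₁ e ==ᶠ proj₁ f) ∨ (proj₁ e ==ᶠ proj₂ f) ∨
  (proj₂ e ==ᶠ proj₁ f) ∨ (proj₂ e ==ᶠ proj₂ f)

isMatching : ∀ {n m} → Edges n m → EdgeSet m → Bool
isMatching {n} {m} E σ =
  BL.all (λ i → BL.all (λ j →
     not (lookup σ i ∧ lookup σ j ∧ not (i ==ᶠ j)) ∨ not (shareEndpoint (E i) (E j)))
   (allFin m)) (allFin m)

allSubsets : (m : ℕ) → List (EdgeSet m)
allSubsets zero = [] List.∷ List.[]
allSubsets (suc m) = map (true ∷_) (allSubsets m) ++ map (false ∷_) (allSubsets m)

-- Ω : the list of all matchings of G (each exactly once)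
Ω : ∀ {n m} → Edges n m → List (EdgeSet m)
Ω {n} {m} E = filterᵇ (isMatching E) (allSubsets m)

size : ∀ {m} → EdgeSet m → ℕ
size [] = 0
size (true ∷ σ) = suc (size σ)
size (false ∷ σ) = size σ

maxMatchingSize : ∀ {n m} → Edges n m → ℕ
maxMatchingSize E = foldr ℕ._⊔_ 0 (map size (Ω E))

eqSet : ∀ {m} → EdgeSet m → EdgeSet m → Bool
eqSet [] [] = true
eqSet (x ∷ xs) (y ∷ ys) = not (x xor y) ∧ eqSet xs ys

-- total division (q = 0 gives 0); only ever used with nonzero divisors
_/ℚ_ : ℚ → ℚ → ℚ
p /ℚ q with q ℚ.≟ 0ℚ
... | yes _  = 0ℚ
... | no q≢0 = _÷_ p q {{ℚ.≢-nonZero q≢0}}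

ofℕ : ℕ → ℚ
ofℕ k = (+ k) ℚ./ 1

pow : ℚ → ℕ → ℚ
pow x zero = 1ℚ
pow x (suc k) = x * pow x k

sumℚ : List ℚ → ℚ
sumℚ = foldr _+_ 0ℚ

ind : Bool → ℚ
ind b = if b then 1ℚ else 0ℚ

addStep : ∀ {n m} → Edges n m → EdgeSet m → Fin m → EdgeSet m
addStep E σ e = if isMatching E (σ [ e ]≔ true) then σ [ e ]≔ true else σ

-- σ \ {e} (always a matching when σ is)
remStep : ∀ {m} → EdgeSet m → Fin m → EdgeSet m
remStep σ e = σ [ e ]≔ false

trans : ∀ {n m} → Edges n m → ℚ → EdgeSet m → EdgeSet m → ℚ
trans {n} {m} E λ' σ τ = sumℚ (map (λ e →
   (1ℚ /ℚ ofℕ m) *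
     ((λ' /ℚ (1ℚ + λ')) * ind (eqSet (addStep E σ e) τ) +
      (1ℚ /ℚ (1ℚ + λ')) * ind (eqSet (remStep σ e) τ)))
   (allFin m))

partition : ∀ {n m} → Edges n m → ℚ → ℚ
partition E λ' = sumℚ (map (λ x → pow λ' (size x)) (Ω E))

stat : ∀ {n m} → Edges n m → ℚ → EdgeSet m → ℚ
stat E λ' σ = pow λ' (size σ) /ℚ partition E λ'

-- Conductance.  A subset S ⊆ Ω is a boolean vector indexed by positions
-- of the list Ω.

ΩSubset : ∀ {n m} → Edges n m → Set
ΩSubset E = Vec Bool (length (Ω E))

allΩSubsets : ∀ {n m} (E : Edges n m) → List (ΩSubset E)
allΩSubsets E = allSubsets (length (Ω E))

nonemptyProper : ∀ {n m} (E : Edges n m) → ΩSubset E → Bool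
nonemptyProper E S =
  BL.any (λ i → lookup S i) (allFin _) ∧ BL.any (λ i → not (lookup S i)) (allFin _)

massOf : ∀ {n m} (E : Edges n m) → ℚ → (Fin (length (Ω E)) → Bool) → ℚ
massOf E λ' S = sumℚ (map (λ i → ind (S i) * stat E λ' (List.lookup (Ω E) i)) (allFin _))

flow : ∀ {n m} (E : Edges n m) → ℚ → ΩSubset E → ℚ
flow E λ' S = sumℚ (map (λ i → sumℚ (map (λ j →
    ind (lookup S i ∧ not (lookup S j)) *
      (stat E λ' (List.lookup (Ω E) i) *
       trans E λ' (List.lookup (Ω E) i) (List.lookup (Ω E) j)))
  (allFin _))) (allFin _))

ratio : ∀ {n m} (E : Edges n m) → ℚ → ΩSubset E → ℚ
ratio E λ' S =
  flow E λ' S /ℚ (massOf E λ' (lookup S) * massOf E λ' (λ i → not (lookup S i)))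

-- minimum of a list (0 on the empty list; never used on the empty list
-- when m ≥ 1, since then |Ω| ≥ 2)
minList : List ℚ → ℚ
minList List.[] = 0ℚ
minList (x List.∷ xs) = foldr _⊓_ x xs

conductance : ∀ {n m} → Edges n m → ℚ → ℚ
conductance E λ' = minList (map (ratio E λ') (filterᵇ (nonemptyProper E) (allΩSubsets E)))

module Submission where

-- Take S = {M} for a maximum matching M, of size k. Since M is maximum, adding an edge to M never
-- yields a new matching, so the chain leaves M only by deleting one of its k edges, which happens
-- with probability at most (k/m) · 1/(1+λ). Deleting an edge of M gives a matching of weight
-- λ^(k-1), so the weight λ^k of M is at most λ times the weight W of Ω∖S; hence the partition
-- function λ^k + W is at most (1+λ)W and π(Ω∖S) ≥ 1/(1+λ). Therefore
-- flow(S) / (π(S) π(Ω∖S)) ≤ π(M) (k/m) (1/(1+λ)) / (π(M) / (1+λ)) = k/m, and the conductance is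
-- at most this ratio.

open import Defs renaming (trans to P)
open import Algebra.Bundles using (Ring)
import Algebra.Properties.Semiring.Sum as Sum
open import Data.Bool using (Bool; true; false; T; _∧_; _∨_; not; if_then_else_)
import Data.Bool.Properties as Boolₚ
import Data.Bool.ListAction as BoolList
open import Data.Fin as Fin using (Fin)
import Data.Integer as ℤ
import Data.Integer.Properties as ℤₚ
open import Data.Vec as Vec using ([]; _∷_; lookup; _[_]≔_)
import Data.Vec.Properties as Vecₚ
open import Data.List as List using (List; []; _∷_; _++_; map; foldr; filterᵇ; allFin)
import Data.List.Properties as Listₚ
import Data.List.Relation.Unary.All as All
import Data.List.Relation.Unary.All.Properties as Allₚ
open import Data.List.Membership.Propositional using (_∈_; lose)
open import Data.List.Membership.Propositional.Properties
  using (∈-allFin; ∈-map⁺; ∈-map⁻; ∈-++⁺ˡ; ∈-++⁺ʳ; ∈-filter⁺; ∈-filter⁻)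
open import Data.List.Relation.Unary.Any as Any using (here; there)
import Data.List.Relation.Unary.Any.Properties as Anyₚ
open import Data.Nat as ℕ using (ℕ; _≤_)
import Data.Nat.Coprimality as Coprimality
import Data.Nat.Properties as ℕₚ
open import Data.Product using (∃-syntax; _×_; _,_; proj₂)
open import Data.Sum using (inj₁; inj₂)
open import Data.Rational as ℚ using (ℚ; 0ℚ; 1ℚ; _+_; _*_; _<_; 1/_) renaming (_≤_ to _≤ℚ_)
import Data.Rational.Properties as ℚₚ
open import Data.Rational.Solver using (module +-*-Solver)
open import Function using (_∘_; id; Equivalence)
open import Relation.Binary.PropositionalEquality
open import Relation.Nullary using (yes; no; contradiction)
open import Relation.Nullary.Decidable using (T?)

open Sum (Ring.semiring ℚₚ.+-*-ring)
  using (sum; sum-cong-≗; ∑-distrib-+; ∑-comm; *-distribˡ-sum; *-distribʳ-sum; sum-replicate-zero)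

nonNeg-* : ∀ {p q} → 0ℚ ≤ℚ p → 0ℚ ≤ℚ q → 0ℚ ≤ℚ p * q
nonNeg-* {p} {q} 0≤p 0≤q = ℚₚ.nonNegative⁻¹ (p * q)
  {{ℚₚ.nonNeg*nonNeg⇒nonNeg p {{ℚ.nonNegative 0≤p}} q {{ℚ.nonNegative 0≤q}}}}

*-monoˡ-≤ : ∀ {r p q} → 0ℚ ≤ℚ r → p ≤ℚ q → r * p ≤ℚ r * q
*-monoˡ-≤ {r} 0≤r = ℚₚ.*-monoˡ-≤-nonNeg r {{ℚ.nonNegative 0≤r}}

+-cancelˡ-≤ : ∀ p {q r} → p + q ≤ℚ p + r → q ≤ℚ r
+-cancelˡ-≤ p {q} {r} p+q≤p+r = begin
  q              ≡⟨ cancel q ⟨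
  ℚ.- p + (p + q)  ≤⟨ ℚₚ.+-monoʳ-≤ (ℚ.- p) p+q≤p+r ⟩
  ℚ.- p + (p + r)  ≡⟨ cancel r ⟩
  r              ∎
  where
  open ℚₚ.≤-Reasoning
  cancel : ∀ x → ℚ.- p + (p + x) ≡ x
  cancel x = trans (sym (ℚₚ.+-assoc (ℚ.- p) p x)) (trans (cong (_+ x) (ℚₚ.+-inverseˡ p)) (ℚₚ.+-identityˡ x))

1+λ-pos : ∀ {λ'} → 0ℚ ≤ℚ λ' → 0ℚ < 1ℚ + λ'
1+λ-pos {λ'} 0≤λ =
  ℚₚ.<-≤-trans (ℚₚ.positive⁻¹ 1ℚ) (subst (_≤ℚ 1ℚ + λ') (ℚₚ.+-identityʳ 1ℚ) (ℚₚ.+-monoʳ-≤ 1ℚ 0≤λ))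

-- Once ofℕ k is in normal form, 1ℚ + ofℕ k computes to the normalisation of (1 * 1 + k * 1) / 1.
ofℕ-suc : ∀ k → ofℕ (ℕ.suc k) ≡ 1ℚ + ofℕ k
ofℕ-suc k = trans
  (sym (ℚₚ./-cong {p₁ = ℤ.+ 1 ℤ.* ℤ.+ 1 ℤ.+ ℤ.+ k ℤ.* ℤ.+ 1} (cong (ℤ._+_ (ℤ.+ 1)) (ℤₚ.*-identityʳ (ℤ.+ k))) refl))
  (cong (1ℚ +_) (sym (ofℕ≡mkℚ k)))
  where
  ofℕ≡mkℚ : ∀ k → ofℕ k ≡ ℚ.mkℚ (ℤ.+ k) 0 (Coprimality.sym (Coprimality.1-coprimeTo k))
  ofℕ≡mkℚ k = ℚₚ.normalize-coprime (Coprimality.sym (Coprimality.1-coprimeTo k))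

ofℕ-pos : ∀ k → 0ℚ < ofℕ (ℕ.suc k)
ofℕ-pos k = ℚₚ.positive⁻¹ (ofℕ (ℕ.suc k)) {{ℚₚ.normalize-pos (ℕ.suc k) 1}}

ofℕ-nonNeg : ∀ k → 0ℚ ≤ℚ ofℕ k
ofℕ-nonNeg k = ℚₚ.nonNegative⁻¹ (ofℕ k) {{ℚₚ.normalize-nonNeg k 1}}

pow-pos : ∀ {x} → 0ℚ < x → ∀ k → 0ℚ < pow x k
pow-pos 0<x ℕ.zero = ℚₚ.positive⁻¹ 1ℚ
pow-pos {x} 0<x (ℕ.suc k) = ℚₚ.positive⁻¹ (x * pow x k)
  {{ℚₚ.pos*pos⇒pos x {{ℚ.positive 0<x}} (pow x k) {{ℚ.positive (pow-pos 0<x k)}}}}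

/ℚ-*-cancel : ∀ p {q} → 0ℚ < q → (p /ℚ q) * q ≡ p
/ℚ-*-cancel p {q} 0<q with q ℚ.≟ 0ℚ
... | yes refl = contradiction 0<q (ℚₚ.<-irrefl refl)
... | no q≢0 = begin
  p * 1/q * q    ≡⟨ ℚₚ.*-assoc p 1/q q ⟩
  p * (1/q * q)  ≡⟨ cong (p *_) (ℚₚ.*-inverseˡ q {{ℚ.≢-nonZero q≢0}}) ⟩
  p * 1ℚ         ≡⟨ ℚₚ.*-identityʳ p ⟩
  p              ∎
  where
  open ≡-Reasoning
  1/q = (1/ q) {{ℚ.≢-nonZero q≢0}}

-- Both sides are 0ℚ when r is, since x /ℚ 0ℚ = 0ℚ; so no positivity hypothesis is needed.
*-/ℚ : ∀ p q r → p * (q /ℚ r) ≡ (p * q) /ℚ r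
*-/ℚ p q r with r ℚ.≟ 0ℚ
... | yes _ = ℚₚ.*-zeroʳ p
... | no _ = sym (ℚₚ.*-assoc p q _)

1/ℚ-* : ∀ p q → (1ℚ /ℚ q) * p ≡ p /ℚ q
1/ℚ-* p q with q ℚ.≟ 0ℚ
... | yes _ = ℚₚ.*-zeroˡ p
... | no q≢0 = trans (cong (_* p) (ℚₚ.*-identityˡ 1/q)) (ℚₚ.*-comm 1/q p)
  where 1/q = (1/ q) {{ℚ.≢-nonZero q≢0}}

/ℚ-pos : ∀ {p q} → 0ℚ < p → 0ℚ < q → 0ℚ < p /ℚ q
/ℚ-pos {p} {q} 0<p 0<q = ℚₚ.*-cancelʳ-<-nonNeg q {{ℚ.nonNegative (ℚₚ.<⇒≤ 0<q)}}
  (subst₂ _<_ (sym (ℚₚ.*-zeroˡ q)) (sym (/ℚ-*-cancel p 0<q)) 0<p)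

/ℚ-nonNeg : ∀ {p q} → 0ℚ ≤ℚ p → 0ℚ < q → 0ℚ ≤ℚ p /ℚ q
/ℚ-nonNeg {p} {q} 0≤p 0<q = ℚₚ.*-cancelʳ-≤-pos q {{ℚ.positive 0<q}}
  (subst₂ _≤ℚ_ (sym (ℚₚ.*-zeroˡ q)) (sym (/ℚ-*-cancel p 0<q)) 0≤p)

/ℚ-≤ : ∀ {p q r} → 0ℚ < q → p ≤ℚ r * q → p /ℚ q ≤ℚ r
/ℚ-≤ {p} {q} {r} 0<q p≤rq = ℚₚ.*-cancelʳ-≤-pos q {{ℚ.positive 0<q}}
  (subst (_≤ℚ r * q) (sym (/ℚ-*-cancel p 0<q)) p≤rq)

/ℚ-mono-cross : ∀ {p q r s} → 0ℚ < q → 0ℚ < s → p * s ≤ℚ r * q → p /ℚ q ≤ℚ r /ℚ s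
/ℚ-mono-cross {p} {q} {r} {s} 0<q 0<s ps≤rq = /ℚ-≤ 0<q (ℚₚ.*-cancelʳ-≤-pos s {{ℚ.positive 0<s}} (begin
  p * s                ≤⟨ ps≤rq ⟩
  r * q                ≡⟨ cong (_* q) (/ℚ-*-cancel r 0<s) ⟨
  r /ℚ s * s * q       ≡⟨ ℚₚ.*-assoc (r /ℚ s) s q ⟩
  r /ℚ s * (s * q)     ≡⟨ cong (r /ℚ s *_) (ℚₚ.*-comm s q) ⟩
  r /ℚ s * (q * s)     ≡⟨ ℚₚ.*-assoc (r /ℚ s) q s ⟨
  r /ℚ s * q * s       ∎))
  where open ℚₚ.≤-Reasoning

*-/ℚ-*-≤ : ∀ {a t b y} → 0ℚ < a → 0ℚ < b → t ≤ℚ y * b → (a * t) /ℚ (a * b) ≤ℚ y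
*-/ℚ-*-≤ {a} {t} {b} {y} 0<a 0<b t≤yb = /ℚ-≤ 0<ab (begin
  a * t        ≤⟨ *-monoˡ-≤ (ℚₚ.<⇒≤ 0<a) t≤yb ⟩
  a * (y * b)  ≡⟨ solve 3 (λ a y b → a :* (y :* b) := y :* (a :* b)) refl a y b ⟩
  y * (a * b)  ∎)
  where
  open ℚₚ.≤-Reasoning
  open +-*-Solver
  0<ab = ℚₚ.positive⁻¹ (a * b) {{ℚₚ.pos*pos⇒pos a {{ℚ.positive 0<a}} b {{ℚ.positive 0<b}}}}

==ᶠ-refl : ∀ {n} (i : Fin n) → (i ==ᶠ i) ≡ true
==ᶠ-refl i with i Fin.≟ i
... | yes _ = refl
... | no i≢i = contradiction refl i≢i

==ᶠ-≢ : ∀ {n} {i j : Fin n} → i ≢ j → (i ==ᶠ j) ≡ false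
==ᶠ-≢ {i = i} {j} i≢j with i Fin.≟ j
... | yes i≡j = contradiction i≡j i≢j
... | no _ = refl

==ᶠ-false⇒≢ : ∀ {n} {i j : Fin n} → (i ==ᶠ j) ≡ false → i ≢ j
==ᶠ-false⇒≢ {i = i} i==j≡false refl with () ← trans (sym (==ᶠ-refl i)) i==j≡false

==ᶠ-suc : ∀ {n} (i j : Fin n) → (Fin.suc i ==ᶠ Fin.suc j) ≡ (i ==ᶠ j)
==ᶠ-suc i j with i Fin.≟ j
... | yes _ = refl
... | no _ = refl

sumℚ-allFin : ∀ {n} (f : Fin n → ℚ) → sumℚ (map f (allFin n)) ≡ sum f
sumℚ-allFin {n} f = trans (cong sumℚ (Listₚ.map-tabulate id f)) (go f)
  where
  go : ∀ {n} (f : Fin n → ℚ) → sumℚ (List.tabulate f) ≡ sum f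
  go {ℕ.zero} f = refl
  go {ℕ.suc n} f = cong (f Fin.zero +_) (go (f ∘ Fin.suc))

sumℚ-lookup : ∀ {A : Set} (g : A → ℚ) (xs : List A) → sumℚ (map g xs) ≡ sum (g ∘ List.lookup xs)
sumℚ-lookup g [] = refl
sumℚ-lookup g (x ∷ xs) = cong (g x +_) (sumℚ-lookup g xs)

sumℚ-++ : ∀ xs ys → sumℚ (xs ++ ys) ≡ sumℚ xs + sumℚ ys
sumℚ-++ [] ys = sym (ℚₚ.+-identityˡ (sumℚ ys))
sumℚ-++ (x ∷ xs) ys = trans (cong (x +_) (sumℚ-++ xs ys)) (sym (ℚₚ.+-assoc x (sumℚ xs) (sumℚ ys)))

sumℚ-zero : ∀ {A : Set} (xs : List A) → sumℚ (map (λ _ → 0ℚ) xs) ≡ 0ℚ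
sumℚ-zero [] = refl
sumℚ-zero (x ∷ xs) = trans (ℚₚ.+-identityˡ _) (sumℚ-zero xs)

sumℚ-filterᵇ≤ : ∀ {A : Set} {f : A → ℚ} → (∀ x → 0ℚ ≤ℚ f x) → ∀ (p : A → Bool) xs →
  sumℚ (map f (filterᵇ p xs)) ≤ℚ sumℚ (map f xs)
sumℚ-filterᵇ≤ 0≤f p [] = ℚₚ.≤-refl
sumℚ-filterᵇ≤ {f = f} 0≤f p (x ∷ xs) with p x
... | true = ℚₚ.+-monoʳ-≤ (f x) (sumℚ-filterᵇ≤ 0≤f p xs)
... | false = begin
  sumℚ (map f (filterᵇ p xs))  ≤⟨ sumℚ-filterᵇ≤ 0≤f p xs ⟩
  sumℚ (map f xs)              ≡⟨ ℚₚ.+-identityˡ _ ⟨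
  0ℚ + sumℚ (map f xs)         ≤⟨ ℚₚ.+-monoˡ-≤ (sumℚ (map f xs)) (0≤f x) ⟩
  f x + sumℚ (map f xs)        ∎
  where open ℚₚ.≤-Reasoning

ind-nonNeg : ∀ b → 0ℚ ≤ℚ ind b
ind-nonNeg true = ℚₚ.nonNegative⁻¹ 1ℚ
ind-nonNeg false = ℚₚ.≤-refl

ind-split : ∀ b x → ind b * x + ind (not b) * x ≡ x
ind-split true x = trans (cong₂ _+_ (ℚₚ.*-identityˡ x) (ℚₚ.*-zeroˡ x)) (ℚₚ.+-identityʳ x)
ind-split false x = trans (cong₂ _+_ (ℚₚ.*-zeroˡ x) (ℚₚ.*-identityˡ x)) (ℚₚ.+-identityˡ x)

ind-∧ : ∀ a b x → ind (a ∧ b) * x ≡ ind a * (ind b * x)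
ind-∧ true b x = sym (ℚₚ.*-identityˡ (ind b * x))
ind-∧ false b x = trans (ℚₚ.*-zeroˡ x) (sym (ℚₚ.*-zeroˡ (ind b * x)))

sum-mono : ∀ {n} {f g : Fin n → ℚ} → (∀ i → f i ≤ℚ g i) → sum f ≤ℚ sum g
sum-mono {ℕ.zero} f≤g = ℚₚ.≤-refl
sum-mono {ℕ.suc n} f≤g = ℚₚ.+-mono-≤ (f≤g Fin.zero) (sum-mono (f≤g ∘ Fin.suc))

sum-nonNeg : ∀ {n} {f : Fin n → ℚ} → (∀ i → 0ℚ ≤ℚ f i) → 0ℚ ≤ℚ sum f
sum-nonNeg {n} {f} 0≤f = subst (_≤ℚ sum f) (sum-replicate-zero n) (sum-mono 0≤f)

sum-/ℚ : ∀ {n} (f : Fin n → ℚ) z → sum (λ i → f i /ℚ z) ≡ sum f /ℚ z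
sum-/ℚ {n} f z with z ℚ.≟ 0ℚ
... | yes _ = sum-replicate-zero n
... | no _ = sym (*-distribʳ-sum _ f)

sum-indicator : ∀ {n} (p : Fin n) (f : Fin n → ℚ) → sum (λ i → ind (i ==ᶠ p) * f i) ≡ f p
sum-indicator {ℕ.suc n} Fin.zero f = begin
  1ℚ * f Fin.zero + sum (λ i → 0ℚ * f (Fin.suc i))
    ≡⟨ cong₂ _+_ (ℚₚ.*-identityˡ (f Fin.zero))
                 (trans (sum-cong-≗ (ℚₚ.*-zeroˡ ∘ f ∘ Fin.suc)) (sum-replicate-zero n)) ⟩
  f Fin.zero + 0ℚ
    ≡⟨ ℚₚ.+-identityʳ _ ⟩
  f Fin.zero ∎
  where open ≡-Reasoning
sum-indicator {ℕ.suc n} (Fin.suc p) f = begin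
  0ℚ * f Fin.zero + sum (λ i → ind (Fin.suc i ==ᶠ Fin.suc p) * f (Fin.suc i))
    ≡⟨ cong₂ _+_ (ℚₚ.*-zeroˡ (f Fin.zero))
                 (sum-cong-≗ (λ i → cong (λ b → ind b * f (Fin.suc i)) (==ᶠ-suc i p))) ⟩
  0ℚ + sum (λ i → ind (i ==ᶠ p) * f (Fin.suc i))
    ≡⟨ ℚₚ.+-identityˡ _ ⟩
  sum (λ i → ind (i ==ᶠ p) * f (Fin.suc i))
    ≡⟨ sum-indicator p (f ∘ Fin.suc) ⟩
  f (Fin.suc p) ∎
  where open ≡-Reasoning

sumExcept : ∀ {n} → Fin n → (Fin n → ℚ) → ℚ
sumExcept p f = sum (λ i → ind (not (i ==ᶠ p)) * f i)

sum-split : ∀ {n} (p : Fin n) (f : Fin n → ℚ) → sum f ≡ f p + sumExcept p f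
sum-split p f = begin
  sum f
    ≡⟨ sum-cong-≗ (λ i → ind-split (i ==ᶠ p) (f i)) ⟨
  sum (λ i → ind (i ==ᶠ p) * f i + ind (not (i ==ᶠ p)) * f i)
    ≡⟨ ∑-distrib-+ (λ i → ind (i ==ᶠ p) * f i) (λ i → ind (not (i ==ᶠ p)) * f i) ⟩
  sum (λ i → ind (i ==ᶠ p) * f i) + sumExcept p f
    ≡⟨ cong (_+ sumExcept p f) (sum-indicator p f) ⟩
  f p + sumExcept p f ∎
  where open ≡-Reasoning

term≤sum : ∀ {n} {f : Fin n → ℚ} → (∀ i → 0ℚ ≤ℚ f i) → ∀ q → f q ≤ℚ sum f
term≤sum {f = f} 0≤f q = begin
  f q                    ≡⟨ ℚₚ.+-identityʳ (f q) ⟨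
  f q + 0ℚ               ≤⟨ ℚₚ.+-monoʳ-≤ (f q) (sum-nonNeg (λ i → nonNeg-* (ind-nonNeg (not (i ==ᶠ q))) (0≤f i))) ⟩
  f q + sumExcept q f    ≡⟨ sum-split q f ⟨
  sum f                  ∎
  where open ℚₚ.≤-Reasoning

term≤sumExcept : ∀ {n} {p q : Fin n} {f : Fin n → ℚ} → (∀ i → 0ℚ ≤ℚ f i) → q ≢ p → f q ≤ℚ sumExcept p f
term≤sumExcept {p = p} {q} {f} 0≤f q≢p =
  subst (_≤ℚ sumExcept p f) (trans (cong (λ b → ind (not b) * f q) (==ᶠ-≢ q≢p)) (ℚₚ.*-identityˡ (f q)))
    (term≤sum (λ i → nonNeg-* (ind-nonNeg (not (i ==ᶠ p))) (0≤f i)) q)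

sumExcept≤sum : ∀ {n} (p : Fin n) {f : Fin n → ℚ} → (∀ i → 0ℚ ≤ℚ f i) → sumExcept p f ≤ℚ sum f
sumExcept≤sum p {f} 0≤f = begin
  sumExcept p f        ≡⟨ ℚₚ.+-identityˡ _ ⟨
  0ℚ + sumExcept p f   ≤⟨ ℚₚ.+-monoˡ-≤ (sumExcept p f) (0≤f p) ⟩
  f p + sumExcept p f  ≡⟨ sum-split p f ⟨
  sum f                ∎
  where open ℚₚ.≤-Reasoning

[]≔-unchanged : ∀ {m} (v : EdgeSet m) e {b} → lookup v e ≡ b → v [ e ]≔ b ≡ v
[]≔-unchanged v e refl = Vecₚ.[]≔-lookup v e

size-[]≔true : ∀ {m} (v : EdgeSet m) e → lookup v e ≡ false → size (v [ e ]≔ true) ≡ ℕ.suc (size v)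
size-[]≔true (false ∷ v) Fin.zero refl = refl
size-[]≔true (true ∷ v) (Fin.suc e) ve≡false = cong ℕ.suc (size-[]≔true v e ve≡false)
size-[]≔true (false ∷ v) (Fin.suc e) ve≡false = size-[]≔true v e ve≡false

size-[]≔false : ∀ {m} (v : EdgeSet m) e → lookup v e ≡ true → size v ≡ ℕ.suc (size (v [ e ]≔ false))
size-[]≔false (true ∷ v) Fin.zero refl = refl
size-[]≔false (true ∷ v) (Fin.suc e) ve≡true = cong ℕ.suc (size-[]≔false v e ve≡true)
size-[]≔false (false ∷ v) (Fin.suc e) ve≡true = size-[]≔false v e ve≡true

size>0⇒member : ∀ {m} (v : EdgeSet m) → 1 ≤ size v → ∃[ e ] lookup v e ≡ true
size>0⇒member (true ∷ v) _ = Fin.zero , refl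
size>0⇒member (false ∷ v) 1≤|v| with size>0⇒member v 1≤|v|
... | e , ve≡true = Fin.suc e , ve≡true

sum-ind-lookup : ∀ {m} (v : EdgeSet m) → sum (ind ∘ lookup v) ≡ ofℕ (size v)
sum-ind-lookup [] = refl
sum-ind-lookup (true ∷ v) = trans (cong (1ℚ +_) (sum-ind-lookup v)) (sym (ofℕ-suc (size v)))
sum-ind-lookup (false ∷ v) = trans (ℚₚ.+-identityˡ _) (sum-ind-lookup v)

eqSet-refl : ∀ {m} (v : EdgeSet m) → eqSet v v ≡ true
eqSet-refl [] = refl
eqSet-refl (true ∷ v) = eqSet-refl v
eqSet-refl (false ∷ v) = eqSet-refl v

singleton : ∀ {m} → Fin m → EdgeSet m
singleton {m} e = Vec.replicate m false [ e ]≔ true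

lookup-singleton : ∀ {m} (e i : Fin m) → lookup (singleton e) i ≡ true → i ≡ e
lookup-singleton {m} e i ei≡true with i Fin.≟ e
... | yes i≡e = i≡e
... | no i≢e with () ←
  trans (sym (trans (Vecₚ.lookup∘update′ i≢e (Vec.replicate m false) true) (Vecₚ.lookup-replicate i false))) ei≡true

size-singleton : ∀ {m} (e : Fin m) → size (singleton e) ≡ 1
size-singleton {m} e =
  trans (size-[]≔true (Vec.replicate m false) e (Vecₚ.lookup-replicate e false)) (cong ℕ.suc (size-empty m))
  where
  size-empty : ∀ m → size (Vec.replicate m false) ≡ 0
  size-empty ℕ.zero = refl
  size-empty (ℕ.suc m) = size-empty m

lookup-[]≔false : ∀ {m} (v : EdgeSet m) e i → lookup (v [ e ]≔ false) i ≡ true → lookup v i ≡ true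
lookup-[]≔false v e i vi≡true with i Fin.≟ e
... | yes refl with () ← trans (sym (Vecₚ.lookup∘update i v false)) vi≡true
... | no i≢e = trans (sym (Vecₚ.lookup∘update′ i≢e v false)) vi≡true

all-allFin⁻ : ∀ {n} (p : Fin n → Bool) → T (BoolList.all p (allFin n)) → ∀ i → T (p i)
all-allFin⁻ p all-p i = All.lookup (Allₚ.all⁺ p _ all-p) (∈-allFin i)

all-allFin⁺ : ∀ {n} (p : Fin n → Bool) → (∀ i → T (p i)) → T (BoolList.all p (allFin n))
all-allFin⁺ {n} p p-holds = Allₚ.all⁻ p {allFin n} (All.tabulate (λ {i} _ → p-holds i))

any-allFin : ∀ {n} (p : Fin n → Bool) i → T (p i) → T (BoolList.any p (allFin n))
any-allFin p i pi = Anyₚ.any⁺ p (lose (∈-allFin i) pi)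

pairCondition⁻ : ∀ {a b c s} → T (not (a ∧ b ∧ not c) ∨ not s) →
  a ≡ true → b ≡ true → c ≡ false → s ≡ false
pairCondition⁻ {s = false} _ _ _ _ = refl
pairCondition⁻ {true} {true} {false} {true} () refl refl refl

pairCondition⁺ : ∀ {a b c s} → (a ≡ true → b ≡ true → c ≡ false → s ≡ false) →
  T (not (a ∧ b ∧ not c) ∨ not s)
pairCondition⁺ {false} _ = _
pairCondition⁺ {true} {false} _ = _
pairCondition⁺ {true} {true} {true} _ = _
pairCondition⁺ {true} {true} {false} {false} _ = _
pairCondition⁺ {true} {true} {false} {true} h with h refl refl refl
... | ()

Matching : ∀ {n m} → Edges n m → EdgeSet m → Set
Matching E σ = ∀ i j → lookup σ i ≡ true → lookup σ j ≡ true → i ≢ j → shareEndpoint (E i) (E j) ≡ false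

isMatching⁻ : ∀ {n m} (E : Edges n m) σ → T (isMatching E σ) → Matching E σ
isMatching⁻ E σ matching i j σi σj i≢j =
  pairCondition⁻ (all-allFin⁻ _ (all-allFin⁻ _ matching i) j) σi σj (==ᶠ-≢ i≢j)

isMatching⁺ : ∀ {n m} (E : Edges n m) σ → Matching E σ → T (isMatching E σ)
isMatching⁺ E σ matching = all-allFin⁺ _ (λ i → all-allFin⁺ _ (λ j →
  pairCondition⁺ (λ σi σj i==j≡false → matching i j σi σj (==ᶠ-false⇒≢ i==j≡false))))

[]≔false-isMatching : ∀ {n m} (E : Edges n m) σ e → T (isMatching E σ) → T (isMatching E (σ [ e ]≔ false))
[]≔false-isMatching E σ e matching = isMatching⁺ E (σ [ e ]≔ false) (λ i j σi σj →
  isMatching⁻ E σ matching i j (lookup-[]≔false σ e i σi) (lookup-[]≔false σ e j σj))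

singleton-isMatching : ∀ {n m} (E : Edges n m) e → T (isMatching E (singleton e))
singleton-isMatching E e = isMatching⁺ E (singleton e) (λ i j ei ej i≢j →
  contradiction (trans (lookup-singleton e i ei) (sym (lookup-singleton e j ej))) i≢j)

∈-allSubsets : ∀ {m} (v : EdgeSet m) → v ∈ allSubsets m
∈-allSubsets [] = here refl
∈-allSubsets (true ∷ v) = ∈-++⁺ˡ (∈-map⁺ (true ∷_) (∈-allSubsets v))
∈-allSubsets {ℕ.suc m} (false ∷ v) = ∈-++⁺ʳ (map (true ∷_) (allSubsets m)) (∈-map⁺ (false ∷_) (∈-allSubsets v))

∈Ω⁺ : ∀ {n m} (E : Edges n m) v → T (isMatching E v) → v ∈ Ω E
∈Ω⁺ E v = ∈-filter⁺ (T? ∘ isMatching E) (∈-allSubsets v)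

∈Ω⁻ : ∀ {n m} (E : Edges n m) {v} → v ∈ Ω E → T (isMatching E v)
∈Ω⁻ {m = m} E = proj₂ ∘ ∈-filter⁻ (T? ∘ isMatching E) {xs = allSubsets m}

singleton∈Ω : ∀ {n m} (E : Edges n (ℕ.suc m)) → singleton Fin.zero ∈ Ω E
singleton∈Ω E = ∈Ω⁺ E (singleton Fin.zero) (singleton-isMatching E Fin.zero)

occurrences-allSubsets : ∀ {m} (v : EdgeSet m) → sumℚ (map (ind ∘ eqSet v) (allSubsets m)) ≡ 1ℚ
occurrences-allSubsets [] = refl
occurrences-allSubsets {ℕ.suc m} (x ∷ v) = begin
  sumℚ (map F (map (true ∷_) A ++ map (false ∷_) A))
    ≡⟨ cong sumℚ (Listₚ.map-++ F (map (true ∷_) A) (map (false ∷_) A)) ⟩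
  sumℚ (map F (map (true ∷_) A) ++ map F (map (false ∷_) A))
    ≡⟨ sumℚ-++ (map F (map (true ∷_) A)) (map F (map (false ∷_) A)) ⟩
  sumℚ (map F (map (true ∷_) A)) + sumℚ (map F (map (false ∷_) A))
    ≡⟨ cong₂ _+_ (cong sumℚ (Listₚ.map-∘ A)) (cong sumℚ (Listₚ.map-∘ A)) ⟨
  sumℚ (map (F ∘ (true ∷_)) A) + sumℚ (map (F ∘ (false ∷_)) A)
    ≡⟨ by-head x ⟩
  1ℚ ∎
  where
  open ≡-Reasoning
  A = allSubsets m
  F = ind ∘ eqSet (x ∷ v)
  by-head : ∀ x → sumℚ (map (ind ∘ eqSet (x ∷ v) ∘ (true ∷_)) A)
                 + sumℚ (map (ind ∘ eqSet (x ∷ v) ∘ (false ∷_)) A) ≡ 1ℚ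
  by-head true = trans (cong₂ _+_ (occurrences-allSubsets v) (sumℚ-zero A)) (ℚₚ.+-identityʳ 1ℚ)
  by-head false = trans (cong₂ _+_ (sumℚ-zero A) (occurrences-allSubsets v)) (ℚₚ.+-identityˡ 1ℚ)

occurrencesΩ≤1 : ∀ {n m} (E : Edges n m) v → sum (λ j → ind (eqSet v (List.lookup (Ω E) j))) ≤ℚ 1ℚ
occurrencesΩ≤1 {m = m} E v = begin
  sum (λ j → ind (eqSet v (List.lookup (Ω E) j)))  ≡⟨ sumℚ-lookup (ind ∘ eqSet v) (Ω E) ⟨
  sumℚ (map (ind ∘ eqSet v) (Ω E))
    ≤⟨ sumℚ-filterᵇ≤ (ind-nonNeg ∘ eqSet v) (isMatching E) (allSubsets m) ⟩
  sumℚ (map (ind ∘ eqSet v) (allSubsets m))       ≡⟨ occurrences-allSubsets v ⟩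
  1ℚ                                              ∎
  where open ℚₚ.≤-Reasoning

≤-foldr-⊔ : ∀ {x xs} → x ∈ xs → x ≤ foldr ℕ._⊔_ 0 xs
≤-foldr-⊔ {xs = y ∷ ys} (here refl) = ℕₚ.m≤m⊔n y _
≤-foldr-⊔ {xs = y ∷ ys} (there x∈ys) = ℕₚ.m≤n⇒m≤o⊔n y (≤-foldr-⊔ x∈ys)

foldr-⊔-∈ : ∀ x xs → foldr ℕ._⊔_ 0 (x ∷ xs) ∈ x ∷ xs
foldr-⊔-∈ x [] = here (ℕₚ.⊔-identityʳ x)
foldr-⊔-∈ x (y ∷ ys) with ℕₚ.⊔-sel x (foldr ℕ._⊔_ 0 (y ∷ ys))
... | inj₁ x⊔max≡x = here x⊔max≡x
... | inj₂ x⊔max≡max = there (subst (_∈ y ∷ ys) (sym x⊔max≡max) (foldr-⊔-∈ y ys))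

size≤maxMatchingSize : ∀ {n m} (E : Edges n m) {v} → v ∈ Ω E → size v ≤ maxMatchingSize E
size≤maxMatchingSize E v∈Ω = ≤-foldr-⊔ (∈-map⁺ size v∈Ω)

maximumMatching : ∀ {n m} (E : Edges n m) {v} → v ∈ Ω E → ∃[ M ] M ∈ Ω E × size M ≡ maxMatchingSize E
maximumMatching E {v} v∈Ω with Ω E | v∈Ω
... | x ∷ xs | _ with ∈-map⁻ size (foldr-⊔-∈ (size x) (map size xs))
...   | M , M∈Ω , max≡|M| = M , M∈Ω , sym max≡|M|

1≤maxMatchingSize : ∀ {n m} (E : Edges n (ℕ.suc m)) → 1 ≤ maxMatchingSize E
1≤maxMatchingSize {m = m} E =
  subst (_≤ maxMatchingSize E) (size-singleton {ℕ.suc m} Fin.zero) (size≤maxMatchingSize E (singleton∈Ω E))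

maximum-with-predecessor : ∀ {n m} (E : Edges n (ℕ.suc m)) →
  ∃[ p ] ∃[ q ] q ≢ p × size (List.lookup (Ω E) p) ≡ maxMatchingSize E
                      × size (List.lookup (Ω E) p) ≡ ℕ.suc (size (List.lookup (Ω E) q))
maximum-with-predecessor E
  with M , M∈Ω , |M|≡k ← maximumMatching E (singleton∈Ω E)
  with e , e∈M ← size>0⇒member M (subst (1 ≤_) (sym |M|≡k) (1≤maxMatchingSize E))
  = p , q , q≢p , trans (cong size (sym M≡Lp)) |M|≡k
              , trans (cong size (sym M≡Lp)) (trans (size-[]≔false M e e∈M) (cong (ℕ.suc ∘ size) M'≡Lq))
  where
  M' = M [ e ]≔ false
  M'∈Ω = ∈Ω⁺ E M' ([]≔false-isMatching E M e (∈Ω⁻ E M∈Ω))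
  p = Any.index M∈Ω
  q = Any.index M'∈Ω
  M≡Lp : M ≡ List.lookup (Ω E) p
  M≡Lp = Anyₚ.lookup-index M∈Ω
  M'≡Lq : M' ≡ List.lookup (Ω E) q
  M'≡Lq = Anyₚ.lookup-index M'∈Ω
  M'≡M : q ≡ p → M' ≡ M
  M'≡M q≡p = trans M'≡Lq (trans (cong (List.lookup (Ω E)) q≡p) (sym M≡Lp))
  q≢p : q ≢ p
  q≢p q≡p with () ← trans (sym (Vecₚ.lookup∘update e M false)) (trans (cong (λ v → lookup v e) (M'≡M q≡p)) e∈M)

-- Leaving a maximum matching

edgeProb : ℕ → ℚ
edgeProb m = 1ℚ /ℚ ofℕ m

addProb : ℚ → ℚ
addProb λ' = λ' /ℚ (1ℚ + λ')

removeProb : ℚ → ℚ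
removeProb λ' = 1ℚ /ℚ (1ℚ + λ')

edgeProb-nonNeg : ∀ m → 0ℚ ≤ℚ edgeProb (ℕ.suc m)
edgeProb-nonNeg m = /ℚ-nonNeg (ℚₚ.nonNegative⁻¹ 1ℚ) (ofℕ-pos m)

addProb-nonNeg : ∀ {λ'} → 0ℚ ≤ℚ λ' → 0ℚ ≤ℚ addProb λ'
addProb-nonNeg 0≤λ = /ℚ-nonNeg 0≤λ (1+λ-pos 0≤λ)

removeProb-pos : ∀ {λ'} → 0ℚ ≤ℚ λ' → 0ℚ < removeProb λ'
removeProb-pos 0≤λ = /ℚ-pos (ℚₚ.positive⁻¹ 1ℚ) (1+λ-pos 0≤λ)

occurrencesExcept : ∀ {N m} → Fin N → (Fin N → EdgeSet m) → EdgeSet m → ℚ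
occurrencesExcept p L v = sumExcept p (λ j → ind (eqSet v (L j)))

sumExcept-P : ∀ {n m} (E : Edges n m) λ' σ {N} (L : Fin N → EdgeSet m) (p : Fin N) →
  sumExcept p (λ j → P E λ' σ (L j)) ≡
  sum (λ e → edgeProb m * addProb λ' * occurrencesExcept p L (addStep E σ e)
           + edgeProb m * removeProb λ' * occurrencesExcept p L (remStep σ e))
sumExcept-P {m = m} E λ' σ {N} L p = begin
  sum (λ j → c j * sumℚ (map (λ e → move e j) (allFin m)))
    ≡⟨ sum-cong-≗ (λ j → cong (c j *_) (sumℚ-allFin (λ e → move e j))) ⟩
  sum (λ j → c j * sum (λ e → move e j))
    ≡⟨ sum-cong-≗ (λ j → *-distribˡ-sum (c j) (λ e → move e j)) ⟩
  sum (λ j → sum (λ e → c j * move e j))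
    ≡⟨ ∑-comm (λ j e → c j * move e j) ⟩
  sum (λ e → sum (λ j → c j * move e j))
    ≡⟨ sum-cong-≗ (λ e → split-move (ind ∘ eqSet (addStep E σ e) ∘ L) (ind ∘ eqSet (remStep σ e) ∘ L)) ⟩
  sum (λ e → u * a * occurrencesExcept p L (addStep E σ e) + u * b * occurrencesExcept p L (remStep σ e)) ∎
  where
  open ≡-Reasoning
  u = edgeProb m
  a = addProb λ'
  b = removeProb λ'
  c : Fin N → ℚ
  c j = ind (not (j ==ᶠ p))
  move : Fin m → Fin N → ℚ
  move e j = u * (a * ind (eqSet (addStep E σ e) (L j)) + b * ind (eqSet (remStep σ e) (L j)))
  split-move : (x y : Fin N → ℚ) → sum (λ j → c j * (u * (a * x j + b * y j)))
                     ≡ u * a * sum (λ j → c j * x j) + u * b * sum (λ j → c j * y j)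
  split-move x y = begin
    sum (λ j → c j * (u * (a * x j + b * y j)))
      ≡⟨ sum-cong-≗ (λ j → solve 6
           (λ c u a x b y → c :* (u :* (a :* x :+ b :* y)) := u :* a :* (c :* x) :+ u :* b :* (c :* y))
           refl (c j) u a (x j) b (y j)) ⟩
    sum (λ j → u * a * (c j * x j) + u * b * (c j * y j))
      ≡⟨ ∑-distrib-+ (λ j → u * a * (c j * x j)) (λ j → u * b * (c j * y j)) ⟩
    sum (λ j → u * a * (c j * x j)) + sum (λ j → u * b * (c j * y j))
      ≡⟨ cong₂ _+_ (*-distribˡ-sum (u * a) (λ j → c j * x j)) (*-distribˡ-sum (u * b) (λ j → c j * y j)) ⟨
    u * a * sum (λ j → c j * x j) + u * b * sum (λ j → c j * y j) ∎
    where open +-*-Solver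

addStep-maximum : ∀ {n m} (E : Edges n m) {σ} → size σ ≡ maxMatchingSize E → ∀ e → addStep E σ e ≡ σ
addStep-maximum E {σ} maximum e with lookup σ e in σe
... | true rewrite []≔-unchanged σ e σe = if-same (isMatching E σ)
  where
  if-same : ∀ b → (if b then σ else σ) ≡ σ
  if-same true = refl
  if-same false = refl
... | false with isMatching E (σ [ e ]≔ true) in matching
...   | true = contradiction (size≤maxMatchingSize E (∈Ω⁺ E (σ [ e ]≔ true) (Equivalence.from Boolₚ.T-≡ matching)))
                 (ℕₚ.<⇒≱ (ℕₚ.≤-reflexive (sym (trans (size-[]≔true σ e σe) (cong ℕ.suc maximum)))))
...   | false = refl

module _ {n m} (E : Edges n m) (p : Fin (List.length (Ω E))) where

  private
    L = List.lookup (Ω E)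

  occurrencesExcept≤1 : ∀ v → occurrencesExcept p L v ≤ℚ 1ℚ
  occurrencesExcept≤1 v = ℚₚ.≤-trans (sumExcept≤sum p (ind-nonNeg ∘ eqSet v ∘ L)) (occurrencesΩ≤1 E v)

  occurrencesExcept-self : occurrencesExcept p L (L p) ≤ℚ 0ℚ
  occurrencesExcept-self = +-cancelˡ-≤ 1ℚ (begin
    1ℚ + occ                    ≡⟨ cong (λ b → ind b + occ) (eqSet-refl (L p)) ⟨
    ind (eqSet (L p) (L p)) + occ ≡⟨ sum-split p (ind ∘ eqSet (L p) ∘ L) ⟨
    sum (ind ∘ eqSet (L p) ∘ L) ≤⟨ occurrencesΩ≤1 E (L p) ⟩
    1ℚ                          ≡⟨ ℚₚ.+-identityʳ 1ℚ ⟨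
    1ℚ + 0ℚ                     ∎)
    where
    open ℚₚ.≤-Reasoning
    occ = occurrencesExcept p L (L p)

  occurrencesExcept-remStep : ∀ e → occurrencesExcept p L (remStep (L p) e) ≤ℚ ind (lookup (L p) e)
  occurrencesExcept-remStep e with lookup (L p) e in present
  ... | true = occurrencesExcept≤1 (remStep (L p) e)
  ... | false =
    subst (λ v → occurrencesExcept p L v ≤ℚ 0ℚ) (sym ([]≔-unchanged (L p) e present)) occurrencesExcept-self

escape≤ : ∀ {n m} (E : Edges n (ℕ.suc m)) {λ'} → 0ℚ ≤ℚ λ' → ∀ p →
  size (List.lookup (Ω E) p) ≡ maxMatchingSize E →
  sumExcept p (λ j → P E λ' (List.lookup (Ω E) p) (List.lookup (Ω E) j))
    ≤ℚ edgeProb (ℕ.suc m) * removeProb λ' * ofℕ (size (List.lookup (Ω E) p))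
escape≤ {m = m} E {λ'} 0≤λ p maximum = begin
  sumExcept p (λ j → P E λ' σ (L j))
    ≡⟨ sumExcept-P E λ' σ L p ⟩
  sum (λ e → u * a * occ (addStep E σ e) + u * b * occ (remStep σ e))
    ≤⟨ sum-mono per-edge ⟩
  sum (λ e → u * b * ind (lookup σ e))
    ≡⟨ *-distribˡ-sum (u * b) (ind ∘ lookup σ) ⟨
  u * b * sum (ind ∘ lookup σ)
    ≡⟨ cong (u * b *_) (sum-ind-lookup σ) ⟩
  u * b * ofℕ (size σ) ∎
  where
  open ℚₚ.≤-Reasoning
  L = List.lookup (Ω E)
  σ = L p
  u = edgeProb (ℕ.suc m)
  a = addProb λ'
  b = removeProb λ'
  occ = occurrencesExcept p L
  0≤ua = nonNeg-* (edgeProb-nonNeg m) (addProb-nonNeg 0≤λ)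
  0≤ub = nonNeg-* (edgeProb-nonNeg m) (ℚₚ.<⇒≤ (removeProb-pos 0≤λ))
  per-edge : ∀ e → u * a * occ (addStep E σ e) + u * b * occ (remStep σ e) ≤ℚ u * b * ind (lookup σ e)
  per-edge e = begin
    u * a * occ (addStep E σ e) + u * b * occ (remStep σ e)
      ≡⟨ cong (λ v → u * a * occ v + u * b * occ (remStep σ e)) (addStep-maximum E {σ} maximum e) ⟩
    u * a * occ σ + u * b * occ (remStep σ e)
      ≤⟨ ℚₚ.+-mono-≤ (*-monoˡ-≤ 0≤ua (occurrencesExcept-self E p)) (*-monoˡ-≤ 0≤ub (occurrencesExcept-remStep E p e)) ⟩
    u * a * 0ℚ + u * b * ind (lookup σ e)
      ≡⟨ cong (_+ u * b * ind (lookup σ e)) (ℚₚ.*-zeroʳ (u * a)) ⟩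
    0ℚ + u * b * ind (lookup σ e)
      ≡⟨ ℚₚ.+-identityˡ _ ⟩
    u * b * ind (lookup σ e) ∎

-- The stationary distribution

weight : ∀ {n m} (E : Edges n m) → ℚ → Fin (List.length (Ω E)) → ℚ
weight E λ' i = pow λ' (size (List.lookup (Ω E) i))

module _ {n m} (E : Edges n m) {λ'} (0<λ : 0ℚ < λ') where

  private
    w = weight E λ'
    Z = partition E λ'
    0≤w : ∀ i → 0ℚ ≤ℚ w i
    0≤w i = ℚₚ.<⇒≤ (pow-pos 0<λ (size (List.lookup (Ω E) i)))
    Z≡∑w : Z ≡ sum w
    Z≡∑w = sumℚ-lookup (pow λ' ∘ size) (Ω E)

  partition-pos : Fin (List.length (Ω E)) → 0ℚ < Z
  partition-pos i =
    ℚₚ.<-≤-trans (pow-pos 0<λ (size (List.lookup (Ω E) i))) (subst (w i ≤ℚ_) (sym Z≡∑w) (term≤sum 0≤w i))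

  partition≤ : ∀ {p q} → q ≢ p → size (List.lookup (Ω E) p) ≡ ℕ.suc (size (List.lookup (Ω E) q)) →
    Z ≤ℚ sumExcept p w * (1ℚ + λ')
  partition≤ {p} {q} q≢p |Lp|≡1+|Lq| = begin
    Z                     ≡⟨ Z≡∑w ⟩
    sum w                 ≡⟨ sum-split p w ⟩
    w p + W               ≡⟨ cong (λ k → pow λ' k + W) |Lp|≡1+|Lq| ⟩
    λ' * w q + W          ≤⟨ ℚₚ.+-monoˡ-≤ W (*-monoˡ-≤ (ℚₚ.<⇒≤ 0<λ) (term≤sumExcept 0≤w q≢p)) ⟩
    λ' * W + W            ≡⟨ solve 2 (λ l w → l :* w :+ w := w :* (con 1ℚ :+ l)) refl λ' W ⟩
    W * (1ℚ + λ')         ∎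
    where
    open ℚₚ.≤-Reasoning
    open +-*-Solver
    W = sumExcept p w

  sumExcept-stat : ∀ p → sumExcept p (stat E λ' ∘ List.lookup (Ω E)) ≡ sumExcept p w /ℚ Z
  sumExcept-stat p = trans (sum-cong-≗ (λ i → *-/ℚ (ind (not (i ==ᶠ p))) (w i) Z))
                           (sum-/ℚ (λ i → ind (not (i ==ᶠ p)) * w i) Z)

  removeProb≤sumExcept-stat : ∀ {p q} → q ≢ p → size (List.lookup (Ω E) p) ≡ ℕ.suc (size (List.lookup (Ω E) q)) →
    removeProb λ' ≤ℚ sumExcept p (stat E λ' ∘ List.lookup (Ω E))
  removeProb≤sumExcept-stat {p} q≢p |Lp|≡1+|Lq| =
    subst (removeProb λ' ≤ℚ_) (sym (sumExcept-stat p))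
      (/ℚ-mono-cross (1+λ-pos (ℚₚ.<⇒≤ 0<λ)) (partition-pos p)
        (subst (_≤ℚ sumExcept p w * (1ℚ + λ')) (sym (ℚₚ.*-identityˡ Z)) (partition≤ q≢p |Lp|≡1+|Lq|)))

-- Conductance of a single maximum matching

minList≤ : ∀ {x xs} → x ∈ xs → minList xs ≤ℚ x
minList≤ {xs = y ∷ ys} = foldr-⊓≤ ys
  where
  foldr-⊓≤ : ∀ {x y} zs → x ∈ y ∷ zs → foldr ℚ._⊓_ y zs ≤ℚ x
  foldr-⊓≤ [] (here refl) = ℚₚ.≤-refl
  foldr-⊓≤ (z ∷ zs) (here refl) = ℚₚ.≤-trans (ℚₚ.p⊓q≤q z _) (foldr-⊓≤ zs (here refl))
  foldr-⊓≤ (z ∷ zs) (there (here refl)) = ℚₚ.p⊓q≤p z _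
  foldr-⊓≤ (z ∷ zs) (there (there x∈zs)) = ℚₚ.≤-trans (ℚₚ.p⊓q≤q z _) (foldr-⊓≤ zs (there x∈zs))

conductance≤ratio : ∀ {n m} (E : Edges n m) λ' (S : ΩSubset E) → T (nonemptyProper E S) →
  conductance E λ' ≤ℚ ratio E λ' S
conductance≤ratio E λ' S proper =
  minList≤ (∈-map⁺ (ratio E λ') (∈-filter⁺ (T? ∘ nonemptyProper E) (∈-allSubsets S) proper))

pointSubset : ∀ {n m} (E : Edges n m) → Fin (List.length (Ω E)) → ΩSubset E
pointSubset E p = Vec.tabulate (_==ᶠ p)

pointSubset-proper : ∀ {n m} (E : Edges n m) {p q} → q ≢ p → T (nonemptyProper E (pointSubset E p))
pointSubset-proper E {p} {q} q≢p = Equivalence.from Boolₚ.T-∧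
  ( any-allFin _ p (Equivalence.from Boolₚ.T-≡ (trans (Vecₚ.lookup∘tabulate (_==ᶠ p) p) (==ᶠ-refl p)))
  , any-allFin _ q (Equivalence.from Boolₚ.T-not-≡ (trans (Vecₚ.lookup∘tabulate (_==ᶠ p) q) (==ᶠ-≢ q≢p))))

module _ {n m} (E : Edges n m) (λ' : ℚ) (p : Fin (List.length (Ω E))) where

  private
    L = List.lookup (Ω E)
    S = pointSubset E p

    π : Fin (List.length (Ω E)) → ℚ
    π i = stat E λ' (L i)

    lookup-S : ∀ i → lookup S i ≡ (i ==ᶠ p)
    lookup-S = Vecₚ.lookup∘tabulate (_==ᶠ p)

  massOf-point : massOf E λ' (lookup S) ≡ π p
  massOf-point = begin
    massOf E λ' (lookup S)             ≡⟨ sumℚ-allFin (λ i → ind (lookup S i) * π i) ⟩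
    sum (λ i → ind (lookup S i) * π i) ≡⟨ sum-cong-≗ (λ i → cong (λ b → ind b * π i) (lookup-S i)) ⟩
    sum (λ i → ind (i ==ᶠ p) * π i)    ≡⟨ sum-indicator p π ⟩
    π p                                ∎
    where open ≡-Reasoning

  massOf-point-complement : massOf E λ' (not ∘ lookup S) ≡ sumExcept p π
  massOf-point-complement = trans (sumℚ-allFin (λ i → ind (not (lookup S i)) * π i))
    (sum-cong-≗ (λ i → cong (λ b → ind (not b) * π i) (lookup-S i)))

  flow-point : flow E λ' S ≡ π p * sumExcept p (λ j → P E λ' (L p) (L j))
  flow-point = begin
    flow E λ' S
      ≡⟨ sumℚ-allFin (λ i → sumℚ (map (F i) (allFin _))) ⟩
    sum (λ i → sumℚ (map (F i) (allFin _)))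
      ≡⟨ sum-cong-≗ (λ i → sumℚ-allFin (F i)) ⟩
    sum (λ i → sum (F i))
      ≡⟨ sum-cong-≗ (λ i → sum-cong-≗ (λ j →
           trans (cong₂ (λ a b → ind (a ∧ not b) * (π i * Pπ i j)) (lookup-S i) (lookup-S j))
                 (ind-∧ (i ==ᶠ p) (not (j ==ᶠ p)) (π i * Pπ i j)))) ⟩
    sum (λ i → sum (λ j → ind (i ==ᶠ p) * (ind (not (j ==ᶠ p)) * (π i * Pπ i j))))
      ≡⟨ sum-cong-≗ (λ i → *-distribˡ-sum (ind (i ==ᶠ p)) (λ j → ind (not (j ==ᶠ p)) * (π i * Pπ i j))) ⟨
    sum (λ i → ind (i ==ᶠ p) * sumExcept p (λ j → π i * Pπ i j))
      ≡⟨ sum-indicator p (λ i → sumExcept p (λ j → π i * Pπ i j)) ⟩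
    sumExcept p (λ j → π p * Pπ p j)
      ≡⟨ sum-cong-≗ (λ j → solve 3 (λ c x y → c :* (x :* y) := x :* (c :* y)) refl
                                     (ind (not (j ==ᶠ p))) (π p) (Pπ p j)) ⟩
    sum (λ j → π p * (ind (not (j ==ᶠ p)) * Pπ p j))
      ≡⟨ *-distribˡ-sum (π p) (λ j → ind (not (j ==ᶠ p)) * Pπ p j) ⟨
    π p * sumExcept p (Pπ p) ∎
    where
    open ≡-Reasoning
    open +-*-Solver
    Pπ : Fin (List.length (Ω E)) → Fin (List.length (Ω E)) → ℚ
    Pπ i j = P E λ' (L i) (L j)
    F : Fin (List.length (Ω E)) → Fin (List.length (Ω E)) → ℚ
    F i j = ind (lookup S i ∧ not (lookup S j)) * (π i * Pπ i j)

conductance≤k/m : ∀ {n m} (E : Edges n (ℕ.suc m)) {λ'} → 0ℚ < λ' → ∀ {p q} → q ≢ p →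
  size (List.lookup (Ω E) p) ≡ maxMatchingSize E →
  size (List.lookup (Ω E) p) ≡ ℕ.suc (size (List.lookup (Ω E) q)) →
  conductance E λ' ≤ℚ ofℕ (maxMatchingSize E) /ℚ ofℕ (ℕ.suc m)
conductance≤k/m {m = m} E {λ'} 0<λ {p} q≢p maximum predecessor = begin
  conductance E λ'                    ≤⟨ conductance≤ratio E λ' (pointSubset E p) (pointSubset-proper E q≢p) ⟩
  ratio E λ' (pointSubset E p)        ≡⟨ cong₂ _/ℚ_ (flow-point E λ' p)
                                                    (cong₂ _*_ (massOf-point E λ' p) (massOf-point-complement E λ' p)) ⟩
  (π p * escape) /ℚ (π p * B)         ≤⟨ *-/ℚ-*-≤ 0<πp 0<B escape≤k/m*B ⟩
  k /ℚ ofℕ (ℕ.suc m)                  ∎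
  where
  open ℚₚ.≤-Reasoning
  L = List.lookup (Ω E)
  π = stat E λ' ∘ L
  k = ofℕ (maxMatchingSize E)
  u = edgeProb (ℕ.suc m)
  b = removeProb λ'
  escape = sumExcept p (λ j → P E λ' (L p) (L j))
  B = sumExcept p π
  b≤B : b ≤ℚ B
  b≤B = removeProb≤sumExcept-stat E 0<λ q≢p predecessor
  0<πp : 0ℚ < π p
  0<πp = /ℚ-pos (pow-pos 0<λ (size (L p))) (partition-pos E 0<λ p)
  0<B : 0ℚ < B
  0<B = ℚₚ.<-≤-trans (removeProb-pos (ℚₚ.<⇒≤ 0<λ)) b≤B
  escape≤k/m*B : escape ≤ℚ k /ℚ ofℕ (ℕ.suc m) * B
  escape≤k/m*B = begin
    escape                   ≤⟨ escape≤ E (ℚₚ.<⇒≤ 0<λ) p maximum ⟩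
    u * b * ofℕ (size (L p)) ≡⟨ cong (λ s → u * b * ofℕ s) maximum ⟩
    u * b * k                ≡⟨ solve 3 (λ u b k → u :* b :* k := u :* k :* b) refl u b k ⟩
    u * k * b                ≡⟨ cong (_* b) (1/ℚ-* k (ofℕ (ℕ.suc m))) ⟩
    k /ℚ ofℕ (ℕ.suc m) * b   ≤⟨ *-monoˡ-≤ (/ℚ-nonNeg (ofℕ-nonNeg (maxMatchingSize E)) (ofℕ-pos m)) b≤B ⟩
    k /ℚ ofℕ (ℕ.suc m) * B   ∎
    where open +-*-Solver

-- The bound does not use that the graph is simple.
mainTheorem6 : ∃[ C ] ((n m : ℕ) (E : Edges n m) → SimpleGraph E → 1 ≤ m →
    (λ' : ℚ) → 0ℚ < λ' →
    conductance E λ' ≤ℚ (C * (ofℕ (maxMatchingSize E) /ℚ ofℕ m)))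
mainTheorem6 = 1ℚ , bound
  where
  bound : (n m : ℕ) (E : Edges n m) → SimpleGraph E → 1 ≤ m → (λ' : ℚ) → 0ℚ < λ' →
    conductance E λ' ≤ℚ 1ℚ * (ofℕ (maxMatchingSize E) /ℚ ofℕ m)
  bound _ ℕ.zero _ _ () _ _
  bound _ (ℕ.suc m) E _ _ λ' 0<λ =
    let p , q , q≢p , maximum , predecessor = maximum-with-predecessor E
    in subst (conductance E λ' ≤ℚ_) (sym (ℚₚ.*-identityˡ _)) (conductance≤k/m E 0<λ q≢p maximum predecessor)
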